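{- Let $F(x)\in\mathbb{Z}[x]$ have positive leading coefficient, let $n_F$ be a positive integer such that whenever $a>n_F$ and $1\le b<a$ we have $F(b)<F(a)$ and $F(a)>0$, and define $$S_F(N)=\sum_{a\le N}\ \sum_{n_F<b<a}\frac{\gcd(F(a),F(b))}{F(a)}.$$ If $S_F(N)=o(N)$ as $N\to\infty$, then the set of lattice points in $\mathbb{Z}_{>0}\times\mathbb{Z}_{>0}$ visible along $F(x)$ has density $1$, i.e. $$D(F)=\lim_{N\to\infty}\frac{\#\{(a,h)\in\{1,\dots,N\}^2 : (a,h)\text{ is visible along }F\}}{N^2}=1.$$
   Context: A lattice point $(a,h)\in\mathbb{Z}_{>0}\times\mathbb{Z}_{>0}$ is visible along $F(x)$ if there exists $t\in\mathbb{Q}$ such that $h=t\,F(a)$ and $a$ is the smallest positive integer $u$ such that $t\,F(u)$ is a positive integer; otherwise it is invisible along $F(x)$. -}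

module Defs where

open import Data.Nat as ℕ using (ℕ; zero; suc)
open import Data.Integer as ℤ using (ℤ; +_; -[1+_])
import Data.Integer.GCD as ℤG
open import Data.Rational as ℚ using (ℚ; _/_; 0ℚ)
open import Data.List using (List; []; _∷_; _++_; [_]; length)
open import Data.List.Membership.Propositional using (_∈_)
open import Data.List.Relation.Unary.Unique.Propositional using (Unique)
open import Data.Product using (Σ; ∃; ∃-syntax; _×_; _,_)
open import Relation.Nullary using (¬_)
open import Relation.Binary.PropositionalEquality using (_≡_)
open import Function.Bundles using (_⇔_)

-- Integer polynomials: coefficient lists, constant term first.
Poly : Set
Poly = List ℤ

eval : Poly → ℤ → ℤ
eval []       x = + 0
eval (c ∷ cs) x = c ℤ.+ x ℤ.* eval cs x

_⟦_⟧ : Poly → ℕ → ℤ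
F ⟦ n ⟧ = eval F (+ n)

LeadingCoeffPositive : Poly → Set
LeadingCoeffPositive F = Σ Poly λ cs → Σ ℤ λ lc → (F ≡ cs ++ [ lc ]) × (ℤ.+0 ℤ.< lc)

ℕtoℚ : ℕ → ℚ
ℕtoℚ n = + n / 1

ℤtoℚ : ℤ → ℚ
ℤtoℚ z = z / 1

IsPosInt : ℚ → Set
IsPosInt q = Σ ℕ λ k → (0 ℕ.< k) × (q ≡ ℕtoℚ k)

Visible : Poly → ℕ → ℕ → Set
Visible F a h = Σ ℚ λ t →
    (ℕtoℚ h ≡ t ℚ.* ℤtoℚ (F ⟦ a ⟧))
  × (1 ℕ.≤ a)
  × IsPosInt (t ℚ.* ℤtoℚ (F ⟦ a ⟧))
  × (∀ u → 1 ℕ.≤ u → u ℕ.< a → ¬ IsPosInt (t ℚ.* ℤtoℚ (F ⟦ u ⟧)))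

IsNF : Poly → ℕ → Set
IsNF F nF = (1 ℕ.≤ nF) ×
  (∀ a b → nF ℕ.< a → 1 ℕ.≤ b → b ℕ.< a → (F ⟦ b ⟧ ℤ.< F ⟦ a ⟧) × (ℤ.+0 ℤ.< F ⟦ a ⟧))

-- Quotient n / d of integers as a rational, for d > 0 (value 0 otherwise;
-- only ever used with d > 0 below).
fracℤ : ℤ → ℤ → ℚ
fracℤ n (+ suc k) = n / suc k
fracℤ n _         = 0ℚ

-- Σ_{i = lo}^{lo + len - 1} f i   (len terms starting at lo).
sumFrom : ℕ → ℕ → (ℕ → ℚ) → ℚ
sumFrom lo zero      f = 0ℚ
sumFrom lo (suc len) f = f lo ℚ.+ sumFrom (suc lo) len f

sum1to : ℕ → (ℕ → ℚ) → ℚ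
sum1to N f = sumFrom 1 N f

-- The inner range n_F < b < a consists of b = n_F+1, …, a-1 (a ∸ (n_F+1) terms;
-- empty when a ≤ n_F + 1). a ranges over 1..N (positive integers).
S : Poly → ℕ → ℕ → ℚ
S F nF N = sum1to N λ a →
  sumFrom (suc nF) (a ℕ.∸ suc nF) λ b →
    fracℤ (ℤG.gcd (F ⟦ a ⟧) (F ⟦ b ⟧)) (F ⟦ a ⟧)

VisibleCount : Poly → ℕ → ℕ → Set
VisibleCount F N c = Σ (List (ℕ × ℕ)) λ L →
    Unique L
  × (length L ≡ c)
  × (∀ a h → ((a , h) ∈ L) ⇔ ((1 ℕ.≤ a) × (a ℕ.≤ N) × (1 ℕ.≤ h) × (h ℕ.≤ N) × Visible F a h))

IsLittleON : (ℕ → ℚ) → Set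
IsLittleON s = ∀ (ε : ℚ) → 0ℚ ℚ.< ε →
  ∃[ N₀ ] ∀ N → N₀ ℕ.≤ N → ℚ.∣ s N ∣ ℚ.< ε ℚ.* ℕtoℚ N

-- D(F) = 1:  ∀ ε > 0, eventually the count c(N) satisfies |c(N)/N² − 1| < ε,
-- written without division as |c(N) − N²| < ε N².
DensityOne : Poly → Set
DensityOne F = ∀ (ε : ℚ) → 0ℚ ℚ.< ε →
  ∃[ N₀ ] ∀ N → N₀ ℕ.≤ N → ∃[ c ] VisibleCount F N c ×
    (ℚ.∣ ℕtoℚ c ℚ.- ℕtoℚ (N ℕ.* N) ∣ ℚ.< ε ℚ.* ℕtoℚ (N ℕ.* N))

{-# OPTIONS --safe #-}
module Submission where

-- A point (a, h) with F(a) ≠ 0 is invisible exactly when some 1 ≤ u < a blocks it: h F(u) is a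
-- positive multiple of F(a), the slope being forced to be h / F(a).  The heights h ≤ N blocked by a
-- fixed u are multiples of F(a) / gcd(F(a), F(u)), so there are at most N gcd(F(a), F(u)) / F(a) of
-- them; summed over n_F < u < a ≤ N this is N S_F(N) = o(N²).  Each of the finitely many u ≤ n_F
-- blocks at most N |F(u)| / F(a) heights, which is small once a is large because F(a) ≥ a − n_F, and
-- the rows below that threshold contribute O(N).

open import Defs
open import Data.Empty using (⊥-elim)
open import Data.List.Base using (List; []; _++_; map; filter; length; applyDownFrom)
open import Data.List.Properties using (length-++; length-map)
open import Data.List.Membership.Propositional using (_∈_)
open import Data.List.Membership.Propositional.Properties
  using ( ∈-++⁺ˡ; ∈-++⁺ʳ; ∈-++⁻; ∈-map⁺; ∈-map⁻; ∈-filter⁺; ∈-filter⁻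
        ; ∈-applyDownFrom⁺; ∈-applyDownFrom⁻)
open import Data.List.Relation.Unary.Unique.Propositional using (Unique; [])
import Data.List.Relation.Unary.Unique.Propositional.Properties as Unique
open import Data.Integer.Base as ℤ using (ℤ; +_; -[1+_]; 0ℤ)
import Data.Integer.GCD as ℤ
import Data.Integer.Properties as ℤ
open import Data.Nat.Base
open import Data.Nat.Divisibility using (_∣_; divides; n∣m*n)
open import Data.Nat.GCD using (gcd; gcd-greatest; c*gcd[m,n]≡gcd[cm,cn]; gcd[m,n]≡0⇒m≡0)
open import Data.Nat.Properties
open import Data.Rational.Base as ℚ using (ℚ; mkℚ; 0ℚ; 1ℚ)
import Data.Rational.Properties as ℚ
open import Data.Rational.Literals using (fromℤ)
import Data.Rational.Unnormalised.Base as ℚᵘ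
import Data.Rational.Unnormalised.Properties as ℚᵘ
open import Data.Product.Base using (Σ; ∃-syntax; _×_; _,_; proj₁; proj₂)
open import Data.Sum.Base using (_⊎_; inj₁; inj₂; [_,_]′)
open import Function.Base using (_∘_)
open import Function.Bundles using (_⇔_; mk⇔)
open import Level using (Level)
open import Relation.Nullary.Decidable using (Dec; yes; no; map′; _×-dec_)
open import Relation.Nullary.Negation using (¬_; contradiction)
open import Relation.Unary using (Pred; Decidable)
open import Relation.Unary.Properties using (∁?)
open import Relation.Binary.PropositionalEquality

private variable
  ℓ : Level

-- Sums over integer ranges

∑ : ℕ → ℕ → (ℕ → ℕ) → ℕ
∑ lo zero      f = 0
∑ lo (suc len) f = f lo + ∑ (suc lo) len f

module _ {lo len : ℕ} where

  lo<lo+1+len : lo < lo + suc len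
  lo<lo+1+len = m<m+n lo z<s

  shift-range : ∀ {i} → i < suc lo + len → i < lo + suc len
  shift-range {i} = subst (i <_) (sym (+-suc lo len))

i<lo+[a∸lo]⇒i<a : ∀ {lo i a} → lo ≤ i → i < lo + (a ∸ lo) → i < a
i<lo+[a∸lo]⇒i<a {lo} {i} {a} lo≤i i< with lo ≤? a
... | yes lo≤a = subst (i <_) (m+[n∸m]≡n lo≤a) i<
... | no lo≰a  = contradiction (subst (i <_) lo+[a∸lo]≡lo i<) (≤⇒≯ lo≤i)
  where lo+[a∸lo]≡lo = trans (cong (_+_ lo) (m≤n⇒m∸n≡0 (<⇒≤ (≰⇒> lo≰a)))) (+-identityʳ lo)

∑-mono-≤ : ∀ lo len {f g : ℕ → ℕ} → (∀ {i} → lo ≤ i → i < lo + len → f i ≤ g i) →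
           ∑ lo len f ≤ ∑ lo len g
∑-mono-≤ lo zero      f≤g = z≤n
∑-mono-≤ lo (suc len) f≤g =
  +-mono-≤ (f≤g ≤-refl lo<lo+1+len) (∑-mono-≤ (suc lo) len λ lo<i i< → f≤g (<⇒≤ lo<i) (shift-range i<))

term≤∑ : ∀ lo len (f : ℕ → ℕ) {i} → lo ≤ i → i < lo + len → f i ≤ ∑ lo len f
term≤∑ lo zero      f lo≤i i<lo = contradiction (≤-<-trans lo≤i i<lo) (<-irrefl (sym (+-identityʳ lo)))
term≤∑ lo (suc len) f {i} lo≤i i< with lo ≟ i
... | yes refl = m≤m+n (f i) _
... | no lo≢i  = m≤n⇒m≤o+n (f lo) (term≤∑ (suc lo) len f (≤∧≢⇒< lo≤i lo≢i) (subst (i <_) (+-suc lo len) i<))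

∑-distrib-+ : ∀ lo len (f g : ℕ → ℕ) → ∑ lo len (λ i → f i + g i) ≡ ∑ lo len f + ∑ lo len g
∑-distrib-+ lo zero      f g = refl
∑-distrib-+ lo (suc len) f g rewrite ∑-distrib-+ (suc lo) len f g =
  interchange (f lo) (g lo) _ _
  where open import Algebra.Properties.CommutativeSemigroup +-commutativeSemigroup using (interchange)

∑-cong : ∀ lo len {f g : ℕ → ℕ} → (∀ i → f i ≡ g i) → ∑ lo len f ≡ ∑ lo len g
∑-cong lo zero      f≗g = refl
∑-cong lo (suc len) f≗g = cong₂ _+_ (f≗g lo) (∑-cong (suc lo) len f≗g)

∑-const : ∀ lo len c → ∑ lo len (λ _ → c) ≡ len * c
∑-const lo zero      c = refl
∑-const lo (suc len) c = cong (_+_ c) (∑-const (suc lo) len c)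

*-distribʳ-∑ : ∀ lo len (f : ℕ → ℕ) c → ∑ lo len f * c ≡ ∑ lo len (λ i → f i * c)
*-distribʳ-∑ lo zero      f c = refl
*-distribʳ-∑ lo (suc len) f c =
  trans (*-distribʳ-+ c (f lo) _) (cong (_+_ (f lo * c)) (*-distribʳ-∑ (suc lo) len f c))

*-distribˡ-∑ : ∀ lo len (f : ℕ → ℕ) c → c * ∑ lo len f ≡ ∑ lo len (λ i → c * f i)
*-distribˡ-∑ lo zero      f c = *-zeroʳ c
*-distribˡ-∑ lo (suc len) f c =
  trans (*-distribˡ-+ c (f lo) _) (cong (_+_ (c * f lo)) (*-distribˡ-∑ (suc lo) len f c))

∑-++ : ∀ lo m n (f : ℕ → ℕ) → ∑ lo (m + n) f ≡ ∑ lo m f + ∑ (lo + m) n f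
∑-++ lo zero    n f = cong (λ lo′ → ∑ lo′ n f) (sym (+-identityʳ lo))
∑-++ lo (suc m) n f rewrite ∑-++ (suc lo) m n f | +-suc lo m = sym (+-assoc (f lo) _ _)

∑-split : ∀ lo {m len} → m ≤ len → ∀ f → ∑ lo len f ≡ ∑ lo m f + ∑ (lo + m) (len ∸ m) f
∑-split lo {m} {len} m≤len f = trans (cong (λ l → ∑ lo l f) (sym (m+[n∸m]≡n m≤len))) (∑-++ lo m (len ∸ m) f)

-- Counting in {1, …, n}

𝟙 : {A : Set ℓ} → Dec A → ℕ
𝟙 (yes _) = 1
𝟙 (no _)  = 0

𝟙≡1 : {A : Set ℓ} (d : Dec A) → A → 𝟙 d ≡ 1
𝟙≡1 (yes _) _ = refl
𝟙≡1 (no ¬a) a = contradiction a ¬a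

count : {P : Pred ℕ ℓ} → Decidable P → ℕ → ℕ
count P? zero    = 0
count P? (suc n) = 𝟙 (P? (suc n)) + count P? n

module _ {P : Pred ℕ ℓ} (P? : Decidable P) where

  count≤n : ∀ n → count P? n ≤ n
  count≤n zero = z≤n
  count≤n (suc n) with P? (suc n)
  ... | yes _ = s≤s (count≤n n)
  ... | no _  = m≤n⇒m≤1+n (count≤n n)

  count+count-∁≡n : ∀ n → count P? n + count (∁? P?) n ≡ n
  count+count-∁≡n zero = refl
  count+count-∁≡n (suc n) with P? (suc n)
  ... | yes _ = cong suc (count+count-∁≡n n)
  ... | no _  = trans (+-suc _ _) (cong suc (count+count-∁≡n n))

  count*≤n* : ∀ {A g} n → (∀ {h} → P h → 0 < h * g × A ∣ h * g) → count P? n * A ≤ n * g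
  count*≤n* zero _ = z≤n
  count*≤n* {A} {g} (suc n) multiple with P? (suc n)
  ... | no _  = ≤-trans (count*≤n* n multiple) (*-monoˡ-≤ g (n≤1+n n))
  ... | yes p with multiple p
  ... | 0<[1+n]g , divides q [1+n]g≡qA = begin
    suc (count P? n) * A ≤⟨ *-monoˡ-≤ A (*-cancelʳ-< A (count P? n) q count*A<q*A) ⟩
    q * A                ≡⟨ [1+n]g≡qA ⟨
    suc n * g            ∎
    where
    open ≤-Reasoning
    instance _ = m*n≢0⇒n≢0 (suc n) {{>-nonZero 0<[1+n]g}}
    count*A<q*A : count P? n * A < q * A
    count*A<q*A = begin-strict
      count P? n * A ≤⟨ count*≤n* n multiple ⟩
      n * g          <⟨ *-monoˡ-< g (n<1+n n) ⟩
      suc n * g      ≡⟨ [1+n]g≡qA ⟩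
      q * A          ∎

count≤∑count : ∀ {Q : Pred ℕ ℓ} {R : ℕ → Pred ℕ ℓ} (Q? : Decidable Q) (R? : ∀ u → Decidable (R u)) lo len n →
               (∀ {h} → 1 ≤ h → h ≤ n → Q h → ∃[ u ] lo ≤ u × u < lo + len × R u h) →
               count Q? n ≤ ∑ lo len (λ u → count (R? u) n)
count≤∑count Q? R? lo len zero    _     = z≤n
count≤∑count Q? R? lo len (suc n) cover = begin
  𝟙 (Q? (suc n)) + count Q? n
    ≤⟨ +-mono-≤ top (count≤∑count Q? R? lo len n λ 1≤h h≤n → cover 1≤h (m≤n⇒m≤1+n h≤n)) ⟩
  ∑ lo len (λ u → 𝟙 (R? u (suc n))) + ∑ lo len (λ u → count (R? u) n)
    ≡⟨ ∑-distrib-+ lo len _ _ ⟨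
  ∑ lo len (λ u → count (R? u) (suc n)) ∎
  where
  open ≤-Reasoning
  top : 𝟙 (Q? (suc n)) ≤ ∑ lo len (λ u → 𝟙 (R? u (suc n)))
  top with Q? (suc n)
  ... | no _ = z≤n
  ... | yes q with cover (s≤s z≤n) ≤-refl q
  ... | u , lo≤u , u< , r =
    subst (_≤ _) (𝟙≡1 (R? u (suc n)) r) (term≤∑ lo len (λ u → 𝟙 (R? u (suc n))) lo≤u u<)

positivesUpTo : ℕ → List ℕ
positivesUpTo = applyDownFrom suc

∈-positivesUpTo⁺ : ∀ {n h} → 1 ≤ h → h ≤ n → h ∈ positivesUpTo n
∈-positivesUpTo⁺ {h = suc h} _ h<n = ∈-applyDownFrom⁺ suc h<n

∈-positivesUpTo⁻ : ∀ {n h} → h ∈ positivesUpTo n → 1 ≤ h × h ≤ n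
∈-positivesUpTo⁻ h∈ with ∈-applyDownFrom⁻ suc h∈
... | _ , i<n , refl = s≤s z≤n , i<n

positivesUpTo-unique : ∀ n → Unique (positivesUpTo n)
positivesUpTo-unique n = Unique.applyDownFrom⁺₁ suc n λ j<i _ → <⇒≢ j<i ∘ sym ∘ suc-injective

length-filter-positivesUpTo : ∀ {P : Pred ℕ ℓ} (P? : Decidable P) n →
                              length (filter P? (positivesUpTo n)) ≡ count P? n
length-filter-positivesUpTo P? zero = refl
length-filter-positivesUpTo P? (suc n) with P? (suc n)
... | yes _ = cong suc (length-filter-positivesUpTo P? n)
... | no _  = length-filter-positivesUpTo P? n

module Listing {P : ℕ → Pred ℕ ℓ} (P? : ∀ a → Decidable (P a)) (n : ℕ) where

  InBox : ℕ → ℕ → Set ℓ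
  InBox a h = 1 ≤ a × a ≤ n × 1 ≤ h × h ≤ n × P a h

  row : ℕ → List (ℕ × ℕ)
  row a = map (a ,_) (filter (P? a) (positivesUpTo n))

  rows : ℕ → ℕ → List (ℕ × ℕ)
  rows lo zero      = []
  rows lo (suc len) = row lo ++ rows (suc lo) len

  ∈-row⁺ : ∀ {a h} → 1 ≤ h → h ≤ n → P a h → (a , h) ∈ row a
  ∈-row⁺ 1≤h h≤n p = ∈-map⁺ (_ ,_) (∈-filter⁺ (P? _) (∈-positivesUpTo⁺ 1≤h h≤n) p)

  ∈-row⁻ : ∀ {a a′ h} → (a′ , h) ∈ row a → a′ ≡ a × 1 ≤ h × h ≤ n × P a h
  ∈-row⁻ {a} ∈row with ∈-map⁻ (a ,_) ∈row
  ... | h , h∈ , refl with ∈-filter⁻ (P? a) h∈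
  ...   | h∈′ , p = refl , proj₁ (∈-positivesUpTo⁻ h∈′) , proj₂ (∈-positivesUpTo⁻ h∈′) , p

  ∈-rows⁺ : ∀ {lo len a h} → lo ≤ a → a < lo + len → 1 ≤ h → h ≤ n → P a h → (a , h) ∈ rows lo len
  ∈-rows⁺ {lo} {zero} lo≤a a<lo = contradiction (≤-<-trans lo≤a a<lo) (<-irrefl (sym (+-identityʳ lo)))
  ∈-rows⁺ {lo} {suc len} {a} lo≤a a< 1≤h h≤n p with lo ≟ a
  ... | yes refl = ∈-++⁺ˡ (∈-row⁺ 1≤h h≤n p)
  ... | no lo≢a  = ∈-++⁺ʳ (row lo) (∈-rows⁺ (≤∧≢⇒< lo≤a lo≢a) (subst (a <_) (+-suc lo len) a<) 1≤h h≤n p)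

  ∈-rows⁻ : ∀ {lo len a h} → (a , h) ∈ rows lo len → lo ≤ a × a < lo + len × 1 ≤ h × h ≤ n × P a h
  ∈-rows⁻ {lo} {suc len} ∈rows with ∈-++⁻ (row lo) ∈rows
  ... | inj₁ ∈row with ∈-row⁻ ∈row
  ...   | refl , rest = ≤-refl , lo<lo+1+len , rest
  ∈-rows⁻ {lo} {suc len} ∈rows | inj₂ ∈rows′ with ∈-rows⁻ ∈rows′
  ...   | lo<a , a< , rest = <⇒≤ lo<a , shift-range a< , rest

  rows-unique : ∀ lo len → Unique (rows lo len)
  rows-unique lo zero      = []
  rows-unique lo (suc len) = Unique.++⁺ row-unique (rows-unique (suc lo) len) disjoint
    where
    row-unique : Unique (row lo)
    row-unique = Unique.map⁺ (cong proj₂) (Unique.filter⁺ (P? lo) (positivesUpTo-unique n))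
    disjoint : ∀ {x} → ¬ (x ∈ row lo × x ∈ rows (suc lo) len)
    disjoint {_ , _} (∈row , ∈rows) with ∈-row⁻ ∈row | ∈-rows⁻ {suc lo} {len} ∈rows
    ... | refl , _ | lo<lo , _ = <-irrefl refl lo<lo

  length-rows : ∀ lo len → length (rows lo len) ≡ ∑ lo len (λ a → count (P? a) n)
  length-rows lo zero      = refl
  length-rows lo (suc len) = begin
    length (row lo ++ rows (suc lo) len)          ≡⟨ length-++ (row lo) ⟩
    length (row lo) + length (rows (suc lo) len)  ≡⟨ cong₂ _+_ length-row (length-rows (suc lo) len) ⟩
    count (P? lo) n + ∑ (suc lo) len (λ a → count (P? a) n) ∎
    where
    open ≡-Reasoning
    length-row : length (row lo) ≡ count (P? lo) n
    length-row = trans (length-map (lo ,_) (filter (P? lo) (positivesUpTo n))) (length-filter-positivesUpTo (P? lo) n)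

  listing : Σ (List (ℕ × ℕ)) λ L → Unique L × length L ≡ ∑ 1 n (λ a → count (P? a) n)
                                 × (∀ a h → ((a , h) ∈ L) ⇔ InBox a h)
  listing = rows 1 n , rows-unique 1 n , length-rows 1 n , λ a h → mk⇔
    (λ ∈rows → let 1≤a , a<1+n , rest = ∈-rows⁻ ∈rows in 1≤a , ≤-pred a<1+n , rest)
    (λ (1≤a , a≤n , 1≤h , h≤n , p) → ∈-rows⁺ 1≤a (s≤s a≤n) 1≤h h≤n p)

-- The embeddings of ℕ and ℤ into ℚ

-- ℤtoℚ z = z / 1 is normalised through a gcd and so does not compute for a variable z,
-- whereas fromℤ z = mkℚ z 0 _ does: ℚ arithmetic on it unfolds to integer arithmetic.
ℤtoℚ≡fromℤ : ∀ z → ℤtoℚ z ≡ fromℤ z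
ℤtoℚ≡fromℤ z = ℚ.↥p/↧p≡p (fromℤ z)

ℤtoℚ-* : ∀ x y → ℤtoℚ (x ℤ.* y) ≡ ℤtoℚ x ℚ.* ℤtoℚ y
ℤtoℚ-* x y rewrite ℤtoℚ≡fromℤ x | ℤtoℚ≡fromℤ y = refl

ℤtoℚ-injective : ∀ {x y} → ℤtoℚ x ≡ ℤtoℚ y → x ≡ y
ℤtoℚ-injective {x} {y} eq rewrite ℤtoℚ≡fromℤ x | ℤtoℚ≡fromℤ y = cong ℚ.↥_ eq

ℕtoℚ-injective : ∀ {m n} → ℕtoℚ m ≡ ℕtoℚ n → m ≡ n
ℕtoℚ-injective = ℤ.+-injective ∘ ℤtoℚ-injective

ℕtoℚ-+ : ∀ m n → ℕtoℚ (m + n) ≡ ℕtoℚ m ℚ.+ ℕtoℚ n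
ℕtoℚ-+ m n rewrite ℤtoℚ≡fromℤ (+ m) | ℤtoℚ≡fromℤ (+ n) =
  ℚ./-cong (trans (ℤ.pos-+ m n) (sym (cong₂ ℤ._+_ (ℤ.*-identityʳ (+ m)) (ℤ.*-identityʳ (+ n))))) refl

ℕtoℚ-* : ∀ m n → ℕtoℚ (m * n) ≡ ℕtoℚ m ℚ.* ℕtoℚ n
ℕtoℚ-* m n = trans (cong ℤtoℚ (ℤ.pos-* m n)) (ℤtoℚ-* (+ m) (+ n))

ℕtoℚ-mono-≤ : ∀ {m n} → m ≤ n → ℕtoℚ m ℚ.≤ ℕtoℚ n
ℕtoℚ-mono-≤ {m} {n} m≤n rewrite ℤtoℚ≡fromℤ (+ m) | ℤtoℚ≡fromℤ (+ n) =
  ℚ.*≤* (ℤ.*-monoʳ-≤-nonNeg (+ 1) (ℤ.+≤+ m≤n))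

ℕtoℚ-mono-< : ∀ {m n} → m < n → ℕtoℚ m ℚ.< ℕtoℚ n
ℕtoℚ-mono-< {m} {n} m<n rewrite ℤtoℚ≡fromℤ (+ m) | ℤtoℚ≡fromℤ (+ n) =
  ℚ.*<* (ℤ.*-monoʳ-<-pos (+ 1) (ℤ.+<+ m<n))

ℕtoℚ-cancel-< : ∀ {m n} → ℕtoℚ m ℚ.< ℕtoℚ n → m < n
ℕtoℚ-cancel-< {m} {n} lt rewrite ℤtoℚ≡fromℤ (+ m) | ℤtoℚ≡fromℤ (+ n) with lt
... | ℚ.*<* m*1<n*1 = ℤ.drop‿+<+ (ℤ.*-cancelʳ-<-nonNeg (+ 1) m*1<n*1)

ℕtoℚ-nonNeg : ∀ n → ℚ.NonNegative (ℕtoℚ n)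
ℕtoℚ-nonNeg n = ℚ.nonNegative {ℕtoℚ n} (ℕtoℚ-mono-≤ {0} {n} z≤n)

ℕtoℚ-pos : ∀ n → ℚ.Positive (ℕtoℚ (suc n))
ℕtoℚ-pos n = ℚ.positive {ℕtoℚ (suc n)} (ℕtoℚ-mono-< {0} {suc n} z<s)

/-*-cancel : ∀ g n → (+ g ℚ./ suc n) ℚ.* ℕtoℚ (suc n) ≡ ℕtoℚ g
/-*-cancel g n = ℚ.toℚᵘ-injective (begin-equality
  ℚ.toℚᵘ (ℚ.fromℚᵘ g/d ℚ.* ℚ.fromℚᵘ d)               ≃⟨ ℚ.toℚᵘ-homo-* (ℚ.fromℚᵘ g/d) (ℚ.fromℚᵘ d) ⟩
  ℚ.toℚᵘ (ℚ.fromℚᵘ g/d) ℚᵘ.* ℚ.toℚᵘ (ℚ.fromℚᵘ d)    ≃⟨ ℚᵘ.*-cong (ℚ.toℚᵘ-fromℚᵘ g/d) (ℚ.toℚᵘ-fromℚᵘ d) ⟩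
  g/d ℚᵘ.* d                                         ≃⟨ ℚᵘ.*≡* (solve 2 (λ g d → g :* d :* 1ℤ := g :* (d :* 1ℤ)) refl (+ g) (+ suc n)) ⟩
  g/1                                                ≃⟨ ℚ.toℚᵘ-fromℚᵘ g/1 ⟨
  ℚ.toℚᵘ (ℚ.fromℚᵘ g/1)                              ∎)
  where
  open ℚᵘ.≤-Reasoning
  open import Data.Integer.Solver using (module +-*-Solver)
  open +-*-Solver
  1ℤ = con (+ 1)
  g/d = ℚᵘ.mkℚᵘ (+ g) n
  d   = ℚᵘ.mkℚᵘ (+ suc n) 0
  g/1 = ℚᵘ.mkℚᵘ (+ g) 0

c*d≤n*g⇒c≤n*g/d : ∀ {c n g d} → c * suc d ≤ n * g → ℕtoℚ c ℚ.≤ ℕtoℚ n ℚ.* (+ g ℚ./ suc d)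
c*d≤n*g⇒c≤n*g/d {c} {n} {g} {d} c*d≤n*g = ℚ.*-cancelʳ-≤-pos D {{ℕtoℚ-pos d}} (begin
  ℕtoℚ c ℚ.* D                     ≡⟨ ℕtoℚ-* c (suc d) ⟨
  ℕtoℚ (c * suc d)                 ≤⟨ ℕtoℚ-mono-≤ c*d≤n*g ⟩
  ℕtoℚ (n * g)                     ≡⟨ ℕtoℚ-* n g ⟩
  ℕtoℚ n ℚ.* ℕtoℚ g                ≡⟨ cong (ℕtoℚ n ℚ.*_) (/-*-cancel g d) ⟨
  ℕtoℚ n ℚ.* (g/d ℚ.* D)           ≡⟨ ℚ.*-assoc (ℕtoℚ n) g/d D ⟨
  ℕtoℚ n ℚ.* g/d ℚ.* D             ∎)
  where
  open ℚ.≤-Reasoning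
  D = ℕtoℚ (suc d)
  g/d = + g ℚ./ suc d

ℚ-*-cancelʳ-≡ : ∀ {p q} r → r ≢ 0ℚ → p ℚ.* r ≡ q ℚ.* r → p ≡ q
ℚ-*-cancelʳ-≡ {p} {q} r r≢0 pr≡qr = begin
  p                     ≡⟨ divide p ⟨
  p ℚ.* r ℚ.* ℚ.1/ r    ≡⟨ cong (ℚ._* ℚ.1/ r) pr≡qr ⟩
  q ℚ.* r ℚ.* ℚ.1/ r    ≡⟨ divide q ⟩
  q                     ∎
  where
  open ≡-Reasoning
  instance _ = ℚ.≢-nonZero r≢0
  divide : ∀ x → x ℚ.* r ℚ.* ℚ.1/ r ≡ x
  divide x = trans (ℚ.*-assoc x r _) (trans (cong (x ℚ.*_) (ℚ.*-inverseʳ r)) (ℚ.*-identityʳ x))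

p≤∣p∣ : ∀ p → p ℚ.≤ ℚ.∣ p ∣
p≤∣p∣ p with ℚ.≤-total 0ℚ p
... | inj₁ 0≤p = ℚ.≤-reflexive (sym (ℚ.0≤p⇒∣p∣≡p 0≤p))
... | inj₂ p≤0 = ℚ.≤-trans p≤0 (ℚ.0≤∣p∣ p)

archimedean : ∀ {ε} → 0ℚ ℚ.< ε → ∃[ m ] 1ℚ ℚ.≤ ε ℚ.* ℕtoℚ (suc m)
archimedean {mkℚ (+ 0) _ _}    (ℚ.*<* 0<0) = contradiction 0<0 (ℤ.<-irrefl refl)
archimedean {mkℚ ℤ.-[1+ _ ] _ _} (ℚ.*<* ())
archimedean {ε@(mkℚ (+ suc n) d _)} _ = d , (begin
  1ℚ                                      ≤⟨ ℕtoℚ-mono-≤ {1} {suc n} (s≤s z≤n) ⟩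
  ℕtoℚ (suc n)                            ≡⟨ /-*-cancel (suc n) d ⟨
  (+ suc n ℚ./ suc d) ℚ.* ℕtoℚ (suc d)   ≡⟨ cong (ℚ._* ℕtoℚ (suc d)) (ℚ.↥p/↧p≡p ε) ⟩
  ε ℚ.* ℕtoℚ (suc d)                      ∎)
  where open ℚ.≤-Reasoning

ℕtoℚ-∑ : ∀ lo len f → ℕtoℚ (∑ lo len f) ≡ sumFrom lo len (ℕtoℚ ∘ f)
ℕtoℚ-∑ lo zero      f = refl
ℕtoℚ-∑ lo (suc len) f = trans (ℕtoℚ-+ (f lo) _) (cong (ℕtoℚ (f lo) ℚ.+_) (ℕtoℚ-∑ (suc lo) len f))

sumFrom-mono-≤ : ∀ lo len {f g : ℕ → ℚ} → (∀ {i} → lo ≤ i → i < lo + len → f i ℚ.≤ g i) →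
                 sumFrom lo len f ℚ.≤ sumFrom lo len g
sumFrom-mono-≤ lo zero      f≤g = ℚ.≤-refl
sumFrom-mono-≤ lo (suc len) f≤g =
  ℚ.+-mono-≤ (f≤g ≤-refl lo<lo+1+len) (sumFrom-mono-≤ (suc lo) len λ lo<i i< → f≤g (<⇒≤ lo<i) (shift-range i<))

*-distribˡ-sumFrom : ∀ lo len c (f : ℕ → ℚ) → c ℚ.* sumFrom lo len f ≡ sumFrom lo len (λ i → c ℚ.* f i)
*-distribˡ-sumFrom lo zero      c f = ℚ.*-zeroʳ c
*-distribˡ-sumFrom lo (suc len) c f =
  trans (ℚ.*-distribˡ-+ c (f lo) _) (cong (c ℚ.* f lo ℚ.+_) (*-distribˡ-sumFrom (suc lo) len c f))

∣m-[m+n]∣≡n : ∀ m n → ℚ.∣ ℕtoℚ m ℚ.- ℕtoℚ (m + n) ∣ ≡ ℕtoℚ n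
∣m-[m+n]∣≡n m n = begin
  ℚ.∣ ℕtoℚ m ℚ.- ℕtoℚ (m + n) ∣           ≡⟨ cong (λ x → ℚ.∣ ℕtoℚ m ℚ.- x ∣) (ℕtoℚ-+ m n) ⟩
  ℚ.∣ ℕtoℚ m ℚ.- (ℕtoℚ m ℚ.+ ℕtoℚ n) ∣
    ≡⟨ cong ℚ.∣_∣ (solve 2 (λ x y → x :- (x :+ y) := :- y) refl (ℕtoℚ m) (ℕtoℚ n)) ⟩
  ℚ.∣ ℚ.- ℕtoℚ n ∣                        ≡⟨ ℚ.∣-p∣≡∣p∣ (ℕtoℚ n) ⟩
  ℚ.∣ ℕtoℚ n ∣                            ≡⟨ ℚ.0≤p⇒∣p∣≡p (ℚ.nonNegative⁻¹ (ℕtoℚ n) {{ℕtoℚ-nonNeg n}}) ⟩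
  ℕtoℚ n                                  ∎
  where
  open ≡-Reasoning
  open import Data.Rational.Solver using (module +-*-Solver)
  open +-*-Solver

close-to-total : ∀ {ε} m {c i n} → 0ℚ ℚ.< ε → 1ℚ ℚ.≤ ε ℚ.* ℕtoℚ m → c + i ≡ n → i * m < n →
                 ℚ.∣ ℕtoℚ c ℚ.- ℕtoℚ n ∣ ℚ.< ε ℚ.* ℕtoℚ n
close-to-total {ε} m {c} {i} 0<ε 1≤εm refl i*m<n = begin-strict
  ℚ.∣ ℕtoℚ c ℚ.- ℕtoℚ (c + i) ∣    ≡⟨ ∣m-[m+n]∣≡n c i ⟩
  ℕtoℚ i                           ≡⟨ ℚ.*-identityˡ (ℕtoℚ i) ⟨
  1ℚ ℚ.* ℕtoℚ i                    ≤⟨ ℚ.*-monoʳ-≤-nonNeg (ℕtoℚ i) {{ℕtoℚ-nonNeg i}} 1≤εm ⟩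
  ε ℚ.* ℕtoℚ m ℚ.* ℕtoℚ i          ≡⟨ ℚ.*-assoc ε (ℕtoℚ m) (ℕtoℚ i) ⟩
  ε ℚ.* (ℕtoℚ m ℚ.* ℕtoℚ i)        ≡⟨ cong (ε ℚ.*_) (ℕtoℚ-* m i) ⟨
  ε ℚ.* ℕtoℚ (m * i)
    <⟨ ℚ.*-monoʳ-<-pos ε {{ℚ.positive 0<ε}} (ℕtoℚ-mono-< (subst (_< c + i) (*-comm i m) i*m<n)) ⟩
  ε ℚ.* ℕtoℚ (c + i)               ∎
  where open ℚ.≤-Reasoning

≤n*s⇒*L<n*n : ∀ l n j s → ℕtoℚ j ℚ.≤ ℕtoℚ n ℚ.* s → ℚ.∣ s ∣ ℚ.< (+ 1 ℚ./ suc l) ℚ.* ℕtoℚ n →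
             j * suc l < n * n
≤n*s⇒*L<n*n l zero j s _ ∣s∣<0 =
  ⊥-elim (ℚ.<-irrefl refl (ℚ.≤-<-trans (ℚ.0≤∣p∣ s) (subst (ℚ.∣ s ∣ ℚ.<_) (ℚ.*-zeroʳ (+ 1 ℚ./ suc l)) ∣s∣<0)))
≤n*s⇒*L<n*n l n@(suc n′) j s j≤ns ∣s∣<δn = ℕtoℚ-cancel-< (begin-strict
  ℕtoℚ (j * suc l)            ≡⟨ ℕtoℚ-* j (suc l) ⟩
  ℕtoℚ j ℚ.* L                ≤⟨ ℚ.*-monoʳ-≤-nonNeg L {{ℕtoℚ-nonNeg (suc l)}} j≤ns ⟩
  ν ℚ.* s ℚ.* L
    ≤⟨ ℚ.*-monoʳ-≤-nonNeg L {{ℕtoℚ-nonNeg (suc l)}} (ℚ.*-monoˡ-≤-nonNeg ν {{ℕtoℚ-nonNeg n}} (p≤∣p∣ s)) ⟩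
  ν ℚ.* ℚ.∣ s ∣ ℚ.* L
    <⟨ ℚ.*-monoˡ-<-pos L {{ℕtoℚ-pos l}} (ℚ.*-monoʳ-<-pos ν {{ℕtoℚ-pos n′}} ∣s∣<δn) ⟩
  ν ℚ.* (δ ℚ.* ν) ℚ.* L       ≡⟨ solve 3 (λ ν δ L → ν :* (δ :* ν) :* L := (ν :* ν) :* (δ :* L)) refl ν δ L ⟩
  ν ℚ.* ν ℚ.* (δ ℚ.* L)       ≡⟨ cong (ν ℚ.* ν ℚ.*_) (/-*-cancel 1 l) ⟩
  ν ℚ.* ν ℚ.* 1ℚ              ≡⟨ ℚ.*-identityʳ (ν ℚ.* ν) ⟩
  ν ℚ.* ν                     ≡⟨ ℕtoℚ-* n n ⟨
  ℕtoℚ (n * n)                ∎)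
  where
  open ℚ.≤-Reasoning
  open import Data.Rational.Solver using (module +-*-Solver)
  open +-*-Solver
  L = ℕtoℚ (suc l)
  ν = ℕtoℚ n
  δ = + 1 ℚ./ suc l

infix 4 _∣⁺_ _∣⁺?_

_∣⁺_ : ℤ → ℤ → Set
y ∣⁺ x = ∃[ k ] 1 ≤ k × x ≡ + k ℤ.* y

∣⁺-abs : ∀ {x y} → y ∣⁺ x → ∃[ k ] 1 ≤ k × ℤ.∣ x ∣ ≡ k * ℤ.∣ y ∣
∣⁺-abs {y = y} (k , 1≤k , x≡ky) = k , 1≤k , trans (cong ℤ.∣_∣ x≡ky) (ℤ.abs-* (+ k) y)

_∣⁺?_ : ∀ y x → Dec (y ∣⁺ x)
y ∣⁺? x with y ℤ.≟ 0ℤ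
... | yes refl = map′ (λ x≡0 → 1 , ≤-refl , trans x≡0 (sym (ℤ.*-zeroʳ (+ 1))))
                      (λ (k , _ , x≡k*0) → trans x≡k*0 (ℤ.*-zeroʳ (+ k)))
                      (x ℤ.≟ 0ℤ)
... | no y≢0   = map′ (λ (k , _ , y∣⁺x) → k , y∣⁺x)
                      (λ (k , 1≤k , x≡ky) → k , s≤s (k≤∣x∣ x≡ky) , 1≤k , x≡ky)
                      (anyUpTo? (λ k → (1 ≤? k) ×-dec (x ℤ.≟ + k ℤ.* y)) (suc ℤ.∣ x ∣))
  where
  k≤∣x∣ : ∀ {k} → x ≡ + k ℤ.* y → k ≤ ℤ.∣ x ∣
  k≤∣x∣ {k} x≡ky = subst (k ≤_) (sym (trans (cong ℤ.∣_∣ x≡ky) (ℤ.abs-* (+ k) y)))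
                         (m≤m*n k ℤ.∣ y ∣ {{≢-nonZero (y≢0 ∘ ℤ.∣i∣≡0⇒i≡0)}})

module Visibility (F : Poly) where

  -- u blocks (a, h) when the slope t = h / F(a) also makes t F(u) a positive integer.
  Blocks : ℕ → ℕ → ℕ → Set
  Blocks u a h = F ⟦ a ⟧ ∣⁺ (+ h ℤ.* F ⟦ u ⟧)

  blocks? : ∀ u a h → Dec (Blocks u a h)
  blocks? u a h = F ⟦ a ⟧ ∣⁺? (+ h ℤ.* F ⟦ u ⟧)

  private
    swap : ∀ t x y → t ℚ.* x ℚ.* y ≡ t ℚ.* y ℚ.* x
    swap = xy∙z≈xz∙y
      where
      open import Algebra.Bundles using (CommutativeMonoid)
      open import Algebra.Properties.CommutativeSemigroup
        (CommutativeMonoid.commutativeSemigroup ℚ.*-1-commutativeMonoid) using (xy∙z≈xz∙y)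

  isPosInt⇒blocks : ∀ {t u a h} → ℕtoℚ h ≡ t ℚ.* ℤtoℚ (F ⟦ a ⟧) →
                    IsPosInt (t ℚ.* ℤtoℚ (F ⟦ u ⟧)) → Blocks u a h
  isPosInt⇒blocks {t} {u} {a} {h} h≡tFa (k , 1≤k , tFu≡k) = k , 1≤k , ℤtoℚ-injective (begin
    ℤtoℚ (+ h ℤ.* F ⟦ u ⟧)   ≡⟨ ℤtoℚ-* (+ h) (F ⟦ u ⟧) ⟩
    ℕtoℚ h ℚ.* Fu            ≡⟨ cong (ℚ._* Fu) h≡tFa ⟩
    t ℚ.* Fa ℚ.* Fu          ≡⟨ swap t Fa Fu ⟩
    t ℚ.* Fu ℚ.* Fa          ≡⟨ cong (ℚ._* Fa) tFu≡k ⟩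
    ℕtoℚ k ℚ.* Fa            ≡⟨ ℤtoℚ-* (+ k) (F ⟦ a ⟧) ⟨
    ℤtoℚ (+ k ℤ.* F ⟦ a ⟧)   ∎)
    where
    open ≡-Reasoning
    Fa = ℤtoℚ (F ⟦ a ⟧)
    Fu = ℤtoℚ (F ⟦ u ⟧)

  blocks⇒isPosInt : ∀ {t u a h} → F ⟦ a ⟧ ≢ 0ℤ → ℕtoℚ h ≡ t ℚ.* ℤtoℚ (F ⟦ a ⟧) →
                    Blocks u a h → IsPosInt (t ℚ.* ℤtoℚ (F ⟦ u ⟧))
  blocks⇒isPosInt {t} {u} {a} {h} Fa≢0 h≡tFa (k , 1≤k , hFu≡kFa) =
    k , 1≤k , ℚ-*-cancelʳ-≡ Fa (Fa≢0 ∘ ℤtoℚ-injective) (begin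
      t ℚ.* Fu ℚ.* Fa          ≡⟨ swap t Fu Fa ⟩
      t ℚ.* Fa ℚ.* Fu          ≡⟨ cong (ℚ._* Fu) h≡tFa ⟨
      ℕtoℚ h ℚ.* Fu            ≡⟨ ℤtoℚ-* (+ h) (F ⟦ u ⟧) ⟨
      ℤtoℚ (+ h ℤ.* F ⟦ u ⟧)   ≡⟨ cong ℤtoℚ hFu≡kFa ⟩
      ℤtoℚ (+ k ℤ.* F ⟦ a ⟧)   ≡⟨ ℤtoℚ-* (+ k) (F ⟦ a ⟧) ⟩
      ℕtoℚ k ℚ.* Fa            ∎)
    where
    open ≡-Reasoning
    Fa = ℤtoℚ (F ⟦ a ⟧)
    Fu = ℤtoℚ (F ⟦ u ⟧)

  Unblocked : ℕ → ℕ → Set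
  Unblocked a h = ∀ {u} → 1 ≤ u → u < a → ¬ Blocks u a h

  visible⇒ : ∀ {a h} → Visible F a h → 1 ≤ h × F ⟦ a ⟧ ≢ 0ℤ × Unblocked a h
  visible⇒ {a} {h} (t , h≡tFa , _ , (k , 1≤k , tFa≡k) , minimal) =
    1≤h , Fa≢0 , λ {u} 1≤u u<a b → minimal u 1≤u u<a (blocks⇒isPosInt {t} {u} {a} {h} Fa≢0 h≡tFa b)
    where
    1≤h : 1 ≤ h
    1≤h = subst (1 ≤_) (ℕtoℚ-injective {k} {h} (sym (trans h≡tFa tFa≡k))) 1≤k
    Fa≢0 : F ⟦ a ⟧ ≢ 0ℤ
    Fa≢0 Fa≡0 = <⇒≢ 1≤h (sym (ℕtoℚ-injective {h} {0} h≡0))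
      where h≡0 = trans h≡tFa (trans (cong (λ z → t ℚ.* ℤtoℚ z) Fa≡0) (ℚ.*-zeroʳ t))

  visible⇐ : ∀ {a h} → 1 ≤ a → 1 ≤ h → F ⟦ a ⟧ ≢ 0ℤ → Unblocked a h → Visible F a h
  visible⇐ {a} {h} 1≤a 1≤h Fa≢0 unblocked =
    t , sym tFa≡h , 1≤a , (h , 1≤h , tFa≡h) ,
    λ u 1≤u u<a tFu-posInt → unblocked 1≤u u<a (isPosInt⇒blocks {t} {u} {a} {h} (sym tFa≡h) tFu-posInt)
    where
    Fa = ℤtoℚ (F ⟦ a ⟧)
    instance _ = ℚ.≢-nonZero (Fa≢0 ∘ ℤtoℚ-injective)
    t = ℕtoℚ h ℚ.* ℚ.1/ Fa
    tFa≡h : t ℚ.* Fa ≡ ℕtoℚ h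
    tFa≡h = trans (ℚ.*-assoc (ℕtoℚ h) _ Fa) (trans (cong (ℕtoℚ h ℚ.*_) (ℚ.*-inverseˡ Fa)) (ℚ.*-identityʳ _))

  visible-or-blocked : ∀ {a h} → 1 ≤ a → 1 ≤ h → F ⟦ a ⟧ ≢ 0ℤ →
                       Visible F a h ⊎ ∃[ u ] 1 ≤ u × u < a × Blocks u a h
  visible-or-blocked {a} {h} 1≤a 1≤h Fa≢0 with anyUpTo? (λ u → (1 ≤? u) ×-dec blocks? u a h) a
  ... | yes (u , u<a , 1≤u , b) = inj₂ (u , 1≤u , u<a , b)
  ... | no none = inj₁ (visible⇐ 1≤a 1≤h Fa≢0 λ 1≤u u<a b → none (_ , u<a , 1≤u , b))

  visible? : ∀ a h → Dec (Visible F a h)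
  visible? a h with 1 ≤? a | 1 ≤? h | F ⟦ a ⟧ ℤ.≟ 0ℤ
  ... | no 1≰a  | _       | _        = no λ (_ , _ , 1≤a , _) → 1≰a 1≤a
  ... | yes _   | no 1≰h  | _        = no λ v → let 1≤h , _ = visible⇒ {a} {h} v in 1≰h 1≤h
  ... | yes _   | yes _   | yes Fa≡0 = no λ v → let _ , Fa≢0 , _ = visible⇒ {a} {h} v in Fa≢0 Fa≡0
  ... | yes 1≤a | yes 1≤h | no Fa≢0 with visible-or-blocked 1≤a 1≤h Fa≢0
  ...   | inj₁ v                   = yes v
  ...   | inj₂ (_ , 1≤u , u<a , b) = no λ v → let _ , _ , unblocked = visible⇒ {a} {h} v in unblocked 1≤u u<a b

  invisible⇒blocked : ∀ {a h} → 1 ≤ a → 1 ≤ h → F ⟦ a ⟧ ≢ 0ℤ → ¬ Visible F a h →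
                      ∃[ u ] 1 ≤ u × u < a × Blocks u a h
  invisible⇒blocked 1≤a 1≤h Fa≢0 invisible =
    [ (λ v → contradiction v invisible) , (λ b → b) ]′ (visible-or-blocked 1≤a 1≤h Fa≢0)

  blocks⇒∣F∣-multiple : ∀ {u a h} → Blocks u a h → ∃[ k ] 1 ≤ k × h * ℤ.∣ F ⟦ u ⟧ ∣ ≡ k * ℤ.∣ F ⟦ a ⟧ ∣
  blocks⇒∣F∣-multiple {u} {a} {h} b with ∣⁺-abs b
  ... | k , 1≤k , eq = k , 1≤k , trans (sym (ℤ.abs-* (+ h) (F ⟦ u ⟧))) eq

  module _ (u a n : ℕ) (Fa≢0 : F ⟦ a ⟧ ≢ 0ℤ) where

    private
      0<∣Fa∣ : 0 < ℤ.∣ F ⟦ a ⟧ ∣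
      0<∣Fa∣ = n≢0⇒n>0 (Fa≢0 ∘ ℤ.∣i∣≡0⇒i≡0)

      positive-multiple : ∀ {h} → Blocks u a h → 0 < h * ℤ.∣ F ⟦ u ⟧ ∣ × ℤ.∣ F ⟦ a ⟧ ∣ ∣ h * ℤ.∣ F ⟦ u ⟧ ∣
      positive-multiple {h} b with blocks⇒∣F∣-multiple {u} {a} {h} b
      ... | k , 1≤k , eq = subst (0 <_) (sym eq) (*-mono-≤ 1≤k 0<∣Fa∣) , divides k eq

    count-blocks≤ : count (blocks? u a) n * ℤ.∣ F ⟦ a ⟧ ∣ ≤ n * ℤ.∣ F ⟦ u ⟧ ∣
    count-blocks≤ = count*≤n* (blocks? u a) n λ {h} → positive-multiple {h}

    count-blocks≤gcd : count (blocks? u a) n * ℤ.∣ F ⟦ a ⟧ ∣ ≤ n * gcd ℤ.∣ F ⟦ a ⟧ ∣ ℤ.∣ F ⟦ u ⟧ ∣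
    count-blocks≤gcd = count*≤n* (blocks? u a) n λ {h} b →
      let 0<h∣Fu∣ , ∣Fa∣∣h∣Fu∣ = positive-multiple {h} b
          instance
            _ = m*n≢0⇒m≢0 h {{>-nonZero 0<h∣Fu∣}}
            _ = ≢-nonZero (<⇒≢ 0<∣Fa∣ ∘ sym ∘ gcd[m,n]≡0⇒m≡0)
      in >-nonZero⁻¹ (h * gcd ℤ.∣ F ⟦ a ⟧ ∣ ℤ.∣ F ⟦ u ⟧ ∣) {{m*n≢0 h _}} ,
         subst (ℤ.∣ F ⟦ a ⟧ ∣ ∣_) (sym (c*gcd[m,n]≡gcd[cm,cn] h _ _)) (gcd-greatest (n∣m*n h) ∣Fa∣∣h∣Fu∣)

  visibleInRow invisibleInRow : ℕ → ℕ → ℕ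
  visibleInRow   n a = count (visible? a) n
  invisibleInRow n a = count (∁? (visible? a)) n

  visibleCount invisibleCount : ℕ → ℕ
  visibleCount   n = ∑ 1 n (visibleInRow n)
  invisibleCount n = ∑ 1 n (invisibleInRow n)

  visibleCount-listing : ∀ n → VisibleCount F n (visibleCount n)
  visibleCount-listing n = Listing.listing visible? n

  visible+invisible≡n*n : ∀ n → visibleCount n + invisibleCount n ≡ n * n
  visible+invisible≡n*n n = begin
    visibleCount n + invisibleCount n
      ≡⟨ ∑-distrib-+ 1 n _ _ ⟨
    ∑ 1 n (λ a → visibleInRow n a + invisibleInRow n a)
      ≡⟨ ∑-cong 1 n (λ a → count+count-∁≡n (visible? a) n) ⟩
    ∑ 1 n (λ _ → n)
      ≡⟨ ∑-const 1 n n ⟩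
    n * n ∎
    where open ≡-Reasoning

module Estimates (F : Poly) (nF : ℕ) (isNF : IsNF F nF) where
  open Visibility F

  F-positive : ∀ {a} → nF < a → 0ℤ ℤ.< F ⟦ a ⟧
  F-positive {a} nF<a = proj₂ (proj₂ isNF a 1 nF<a ≤-refl (≤-<-trans (proj₁ isNF) nF<a))

  F≢0 : ∀ {a} → nF < a → F ⟦ a ⟧ ≢ 0ℤ
  F≢0 nF<a Fa≡0 = ℤ.<-irrefl (sym Fa≡0) (F-positive nF<a)

  +∣F∣≡F : ∀ {a} → nF < a → + ℤ.∣ F ⟦ a ⟧ ∣ ≡ F ⟦ a ⟧
  +∣F∣≡F = ℤ.0≤i⇒+∣i∣≡i ∘ ℤ.<⇒≤ ∘ F-positive

  ∣F∣-increasing : ∀ {a b} → nF < b → b < a → ℤ.∣ F ⟦ b ⟧ ∣ < ℤ.∣ F ⟦ a ⟧ ∣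
  ∣F∣-increasing {a} {b} nF<b b<a =
    ℤ.drop‿+<+ (subst₂ ℤ._<_ (sym (+∣F∣≡F nF<b)) (sym (+∣F∣≡F nF<a)) Fb<Fa)
    where
    nF<a = <-trans nF<b b<a
    Fb<Fa = proj₁ (proj₂ isNF a b nF<a (≤-trans (s≤s z≤n) nF<b) b<a)

  a∸nF≤∣F⟦a⟧∣ : ∀ {a} → nF < a → a ∸ nF ≤ ℤ.∣ F ⟦ a ⟧ ∣
  a∸nF≤∣F⟦a⟧∣ {suc a} (s≤s nF≤a) with m≤n⇒m<n∨m≡n nF≤a
  ... | inj₂ refl = subst (_≤ ℤ.∣ F ⟦ suc a ⟧ ∣) (sym (m+n∸n≡m 1 a)) (n≢0⇒n>0 (F≢0 ≤-refl ∘ ℤ.∣i∣≡0⇒i≡0))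
  ... | inj₁ nF<a = begin
    suc a ∸ nF              ≡⟨ +-∸-assoc 1 nF≤a ⟩
    suc (a ∸ nF)            ≤⟨ s≤s (a∸nF≤∣F⟦a⟧∣ nF<a) ⟩
    suc ℤ.∣ F ⟦ a ⟧ ∣        ≤⟨ ∣F∣-increasing nF<a ≤-refl ⟩
    ℤ.∣ F ⟦ suc a ⟧ ∣        ∎
    where open ≤-Reasoning

  S-term : ℕ → ℕ → ℚ
  S-term a u = fracℤ (ℤ.gcd (F ⟦ a ⟧) (F ⟦ u ⟧)) (F ⟦ a ⟧)

  *∣F∣≤*gcd⇒≤*S-term : ∀ {a u c n} → nF < a → c * ℤ.∣ F ⟦ a ⟧ ∣ ≤ n * gcd ℤ.∣ F ⟦ a ⟧ ∣ ℤ.∣ F ⟦ u ⟧ ∣ →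
                       ℕtoℚ c ℚ.≤ ℕtoℚ n ℚ.* S-term a u
  *∣F∣≤*gcd⇒≤*S-term {a} {u} {c} {n} nF<a c*∣Fa∣≤n*g with F ⟦ a ⟧ | F-positive nF<a
  ... | + suc A | _ = c*d≤n*g⇒c≤n*g/d {c} {n} {gcd (suc A) ℤ.∣ F ⟦ u ⟧ ∣} {A} c*∣Fa∣≤n*g
  ... | + 0     | ℤ.+<+ ()
  ... | -[1+ _ ] | ()

  C : ℕ
  C = ∑ 1 nF (λ u → ℤ.∣ F ⟦ u ⟧ ∣)

  module _ (n : ℕ) where

    blocked : ℕ → ℕ → ℕ
    blocked a u = count (blocks? u a) n

    blockedBySmall blockedByLarge : ℕ → ℕ
    blockedBySmall a = ∑ 1 nF (blocked a)
    blockedByLarge a = ∑ (suc nF) (a ∸ suc nF) (blocked a)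

    invisible≤blocked : ∀ {a} → nF < a → invisibleInRow n a ≤ blockedBySmall a + blockedByLarge a
    invisible≤blocked {a} nF<a = begin
      invisibleInRow n a                   ≤⟨ count≤∑count (∁? (visible? a)) (λ u → blocks? u a) 1 (a ∸ 1) n cover ⟩
      ∑ 1 (a ∸ 1) (blocked a)              ≡⟨ cong (λ len → ∑ 1 len (blocked a)) a∸1≡nF+[a∸[1+nF]] ⟩
      ∑ 1 (nF + (a ∸ suc nF)) (blocked a)  ≡⟨ ∑-++ 1 nF (a ∸ suc nF) (blocked a) ⟩
      blockedBySmall a + blockedByLarge a  ∎
      where
      open ≤-Reasoning
      1≤a : 1 ≤ a
      1≤a = ≤-trans (s≤s z≤n) nF<a
      a∸1≡nF+[a∸[1+nF]] : a ∸ 1 ≡ nF + (a ∸ suc nF)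
      a∸1≡nF+[a∸[1+nF]] = sym (trans (cong (_+_ nF) (sym (∸-+-assoc a 1 nF))) (m+[n∸m]≡n (∸-monoˡ-≤ 1 nF<a)))
      cover : ∀ {h} → 1 ≤ h → h ≤ n → ¬ Visible F a h → ∃[ u ] 1 ≤ u × u < 1 + (a ∸ 1) × Blocks u a h
      cover 1≤h _ invisible with invisible⇒blocked 1≤a 1≤h (F≢0 nF<a) invisible
      ... | u , 1≤u , u<a , b = u , 1≤u , subst (u <_) (sym (m+[n∸m]≡n 1≤a)) u<a , b

    blockedBySmall*∣F∣≤n*C : ∀ {a} → nF < a → blockedBySmall a * ℤ.∣ F ⟦ a ⟧ ∣ ≤ n * C
    blockedBySmall*∣F∣≤n*C {a} nF<a = begin
      blockedBySmall a * ℤ.∣ F ⟦ a ⟧ ∣                   ≡⟨ *-distribʳ-∑ 1 nF (blocked a) _ ⟩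
      ∑ 1 nF (λ u → blocked a u * ℤ.∣ F ⟦ a ⟧ ∣)
        ≤⟨ ∑-mono-≤ 1 nF (λ {u} _ _ → count-blocks≤ u a n (F≢0 nF<a)) ⟩
      ∑ 1 nF (λ u → n * ℤ.∣ F ⟦ u ⟧ ∣)                   ≡⟨ *-distribˡ-∑ 1 nF _ n ⟨
      n * C                                              ∎
      where open ≤-Reasoning

    blockedBySmall*L≤n : ∀ L {a} → L * suc C + nF < a → blockedBySmall a * L ≤ n
    blockedBySmall*L≤n L {a} B<a = *-cancelʳ-≤ (blockedBySmall a * L) n (suc C) (begin
      blockedBySmall a * L * suc C       ≡⟨ *-assoc (blockedBySmall a) L (suc C) ⟩
      blockedBySmall a * (L * suc C)     ≤⟨ *-monoʳ-≤ (blockedBySmall a) L*[1+C]≤∣Fa∣ ⟩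
      blockedBySmall a * ℤ.∣ F ⟦ a ⟧ ∣    ≤⟨ blockedBySmall*∣F∣≤n*C nF<a ⟩
      n * C                              ≤⟨ *-monoʳ-≤ n (n≤1+n C) ⟩
      n * suc C                          ∎)
      where
      open ≤-Reasoning
      nF<a : nF < a
      nF<a = ≤-<-trans (m≤n+m nF _) B<a
      L*[1+C]≤∣Fa∣ : L * suc C ≤ ℤ.∣ F ⟦ a ⟧ ∣
      L*[1+C]≤∣Fa∣ = ≤-trans (n≤1+n _) (≤-trans (m+n≤o⇒m≤o∸n (suc (L * suc C)) B<a) (a∸nF≤∣F⟦a⟧∣ nF<a))

    ∑blockedByLarge≤n*S : ℕtoℚ (∑ 1 n blockedByLarge) ℚ.≤ ℕtoℚ n ℚ.* S F nF n
    ∑blockedByLarge≤n*S = begin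
      ℕtoℚ (∑ 1 n blockedByLarge)                       ≡⟨ ℕtoℚ-∑ 1 n blockedByLarge ⟩
      sumFrom 1 n (ℕtoℚ ∘ blockedByLarge)               ≤⟨ sumFrom-mono-≤ 1 n (λ {a} _ _ → row a) ⟩
      sumFrom 1 n (λ a → ℕtoℚ n ℚ.* inner a)           ≡⟨ *-distribˡ-sumFrom 1 n (ℕtoℚ n) inner ⟨
      ℕtoℚ n ℚ.* S F nF n                               ∎
      where
      open ℚ.≤-Reasoning
      inner : ℕ → ℚ
      inner a = sumFrom (suc nF) (a ∸ suc nF) (S-term a)
      row : ∀ a → ℕtoℚ (blockedByLarge a) ℚ.≤ ℕtoℚ n ℚ.* inner a
      row a = begin
        ℕtoℚ (blockedByLarge a)                                  ≡⟨ ℕtoℚ-∑ (suc nF) (a ∸ suc nF) (blocked a) ⟩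
        sumFrom (suc nF) (a ∸ suc nF) (ℕtoℚ ∘ blocked a)         ≤⟨ sumFrom-mono-≤ (suc nF) (a ∸ suc nF) bound ⟩
        sumFrom (suc nF) (a ∸ suc nF) (λ u → ℕtoℚ n ℚ.* S-term a u) ≡⟨ *-distribˡ-sumFrom (suc nF) (a ∸ suc nF) (ℕtoℚ n) (S-term a) ⟨
        ℕtoℚ n ℚ.* inner a                                       ∎
        where
        bound : ∀ {u} → suc nF ≤ u → u < suc nF + (a ∸ suc nF) → ℕtoℚ (blocked a u) ℚ.≤ ℕtoℚ n ℚ.* S-term a u
        bound {u} nF<u u< = *∣F∣≤*gcd⇒≤*S-term {a} {u} {blocked a u} {n} nF<a (count-blocks≤gcd u a n (F≢0 nF<a))
          where nF<a = <-trans nF<u (i<lo+[a∸lo]⇒i<a nF<u u<)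

    invisibleCount≤ : ∀ B → nF ≤ B → B ≤ n →
                      invisibleCount n ≤ B * n + ∑ (suc B) (n ∸ B) blockedBySmall + ∑ 1 n blockedByLarge
    invisibleCount≤ B nF≤B B≤n = begin
      invisibleCount n
        ≡⟨ ∑-split 1 B≤n (invisibleInRow n) ⟩
      ∑ 1 B (invisibleInRow n) + ∑ (suc B) (n ∸ B) (invisibleInRow n)
        ≤⟨ +-mono-≤ head (∑-mono-≤ (suc B) (n ∸ B) λ B<a _ → invisible≤blocked (≤-<-trans nF≤B B<a)) ⟩
      B * n + ∑ (suc B) (n ∸ B) (λ a → blockedBySmall a + blockedByLarge a)
        ≡⟨ trans (cong (_+_ (B * n)) (∑-distrib-+ (suc B) (n ∸ B) _ _)) (sym (+-assoc (B * n) _ _)) ⟩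
      B * n + ∑ (suc B) (n ∸ B) blockedBySmall + ∑ (suc B) (n ∸ B) blockedByLarge
        ≤⟨ +-monoʳ-≤ (B * n + _) large-tail ⟩
      B * n + ∑ (suc B) (n ∸ B) blockedBySmall + ∑ 1 n blockedByLarge ∎
      where
      open ≤-Reasoning
      head : ∑ 1 B (invisibleInRow n) ≤ B * n
      head = ≤-trans (∑-mono-≤ 1 B λ _ _ → count≤n (∁? (visible? _)) n) (≤-reflexive (∑-const 1 B n))
      large-tail : ∑ (suc B) (n ∸ B) blockedByLarge ≤ ∑ 1 n blockedByLarge
      large-tail = ≤-trans (m≤n+m _ _) (≤-reflexive (sym (∑-split 1 B≤n blockedByLarge)))

    invisibleCount*L<3n² : ∀ L → .{{NonZero L}} → (L * suc C + nF) * L ≤ n →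
                           ∑ 1 n blockedByLarge * L < n * n → invisibleCount n * L < 3 * (n * n)
    invisibleCount*L<3n² L B*L≤n large*L<n*n = begin-strict
      invisibleCount n * L
        ≤⟨ *-monoˡ-≤ L (invisibleCount≤ B (m≤n+m nF _) B≤n) ⟩
      (B * n + small + large) * L
        ≡⟨ trans (*-distribʳ-+ L (B * n + small) large) (cong (_+ large * L) (*-distribʳ-+ L (B * n) small)) ⟩
      B * n * L + small * L + large * L
        <⟨ +-mono-≤-< (+-mono-≤ B*n*L≤n*n small*L≤n*n) large*L<n*n ⟩
      n * n + n * n + n * n
        ≡⟨ trans (+-assoc (n * n) _ _) (cong (λ x → n * n + (n * n + x)) (sym (+-identityʳ (n * n)))) ⟩
      3 * (n * n) ∎
      where
      open ≤-Reasoning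
      B = L * suc C + nF
      small = ∑ (suc B) (n ∸ B) blockedBySmall
      large = ∑ 1 n blockedByLarge
      B≤n : B ≤ n
      B≤n = ≤-trans (m≤m*n B L) B*L≤n
      B*n*L≤n*n : B * n * L ≤ n * n
      B*n*L≤n*n = begin
        B * n * L  ≡⟨ trans (*-assoc B n L) (trans (cong (B *_) (*-comm n L)) (sym (*-assoc B L n))) ⟩
        B * L * n  ≤⟨ *-monoˡ-≤ n B*L≤n ⟩
        n * n      ∎
      small*L≤n*n : small * L ≤ n * n
      small*L≤n*n = begin
        small * L                                        ≡⟨ *-distribʳ-∑ (suc B) (n ∸ B) blockedBySmall L ⟩
        ∑ (suc B) (n ∸ B) (λ a → blockedBySmall a * L)   ≤⟨ ∑-mono-≤ (suc B) (n ∸ B) (λ B<a _ → blockedBySmall*L≤n L B<a) ⟩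
        ∑ (suc B) (n ∸ B) (λ _ → n)                      ≡⟨ ∑-const (suc B) (n ∸ B) n ⟩
        (n ∸ B) * n                                      ≤⟨ *-monoˡ-≤ n (m∸n≤m n B) ⟩
        n * n                                            ∎

  invisibleCount-negligible : IsLittleON (S F nF) → ∀ m → ∃[ N₀ ] ∀ n → N₀ ≤ n → invisibleCount n * suc m < n * n
  invisibleCount-negligible S=o[n] m =
    let N₁ , ∣S∣<n/L = S=o[n] (+ 1 ℚ./ L) (ℚ.positive⁻¹ _ {{ℚ.normalize-pos 1 L}})
    in N₁ + B * L , λ n N₀≤n →
      let large*L<n*n = ≤n*s⇒*L<n*n (m + 2 * suc m) n (∑ 1 n (blockedByLarge n)) (S F nF n)
                          (∑blockedByLarge≤n*S n) (∣S∣<n/L n (m+n≤o⇒m≤o N₁ N₀≤n))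
          invisible*L<3n² = invisibleCount*L<3n² n L (m+n≤o⇒n≤o N₁ N₀≤n) large*L<n*n
      in *-cancelˡ-< 3 _ _ (subst (_< 3 * (n * n)) (x∙yz≈y∙xz (invisibleCount n) 3 (suc m)) invisible*L<3n²)
    where
    open import Algebra.Properties.CommutativeSemigroup *-commutativeSemigroup using (x∙yz≈y∙xz)
    -- each of the three parts bounded in invisibleCount*L<3n² is below n² / L
    L = 3 * suc m
    B = L * suc C + nF

-- The positive leading coefficient only guarantees that some n_F exists; the proof uses IsNF alone.
proposition2p4 : (F : Poly) → LeadingCoeffPositive F →
    (nF : ℕ) → IsNF F nF →
    IsLittleON (S F nF) →
    DensityOne F
proposition2p4 F _ nF isNF S=o[n] ε 0<ε =
  let m , 1≤ε[1+m] = archimedean 0<ε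
      N₀ , negligible = invisibleCount-negligible S=o[n] m
  in N₀ , λ n N₀≤n → visibleCount n , visibleCount-listing n ,
       close-to-total (suc m) {visibleCount n} {invisibleCount n} 0<ε 1≤ε[1+m]
         (visible+invisible≡n*n n) (negligible n N₀≤n)
  where
  open Visibility F
  open Estimates F nF isNF
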